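{- Let $L$ be a near copy of a Latin square with alien entry $\pi=(r_1,c_1,k_1)$ whose displaced native is $k_4$. Suppose that $L$ contains the entries $$\mathcal D=\{(r_1,c_1,k_1),(r_2,c_1,k_2),(r_1,c_2,k_2),(r_2,c_2,k_3),(r_1,c_3,k_3),(r_2,c_3,k_4)\}$$ for rows $r_1$ and $r_2$, columns $c_1,c_2,c_3$, and distinct symbols $k_1,k_2,k_3,k_4$. Suppose that $S$ is a subsquare of $L$ that contains $\pi$. Then $S\cap\mathcal D\subseteq\{(r_1,c_1,k_1),(r_1,c_3,k_3)\}$.
   Context: Matrices are viewed as sets of entries (triples (row, column, symbol)). A Latin square of order $n$ is an $n\times n$ matrix on $n$ symbols with each symbol once in each row and column. For a Latin square $L'$, a cell $(i,j)$ and a symbol $\sigma\neq L'[i,j]$ (possibly not a symbol of $L'$), the matrix obtained by replacing the symbol in cell $(i,j)$ by $\sigma$ is a near copy of $L'$; the entry $(i,j,\sigma)$ is its alien entry and $L'[i,j]$ is the displaced native. A subsquare of a matrix is a $k\times k$ submatrix (on any $k$ rows and $k$ columns) that is a Latin square. -}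

module Defs where

open import Data.Nat using (ℕ)
open import Data.Fin using (Fin)
open import Data.Product using (Σ; ∃; _×_; _,_)
open import Data.Sum using (_⊎_)
open import Data.List using (List; _∷_; [])
open import Relation.Nullary using (¬_)
open import Relation.Binary.PropositionalEquality using (_≡_; _≢_)
open import Function.Definitions using (Injective)

Matrix : ℕ → ℕ → Set
Matrix m n = Fin m → Fin n → ℕ

ExactlyOne : ∀ {n} → (Fin n → Set) → Set
ExactlyOne {n} P = Σ (Fin n) λ x → P x × (∀ y → P y → y ≡ x)

IsLatin : (n : ℕ) → Matrix n n → Set
IsLatin n L = Σ (Fin n → ℕ) λ sym →
    Injective _≡_ _≡_ sym
  × (∀ r c → ∃ λ s → L r c ≡ sym s)
  × (∀ r s → ExactlyOne λ c → L r c ≡ sym s)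
  × (∀ c s → ExactlyOne λ r → L r c ≡ sym s)

NearCopyOf : ∀ {n} → Matrix n n → Matrix n n → Fin n → Fin n → ℕ → Set
NearCopyOf L L' i j σ =
    σ ≢ L' i j
  × L i j ≡ σ
  × (∀ r c → (r ≢ i ⊎ c ≢ j) → L r c ≡ L' r c)

-- Entries (row, column, symbol).
Entry : ℕ → Set
Entry n = Fin n × Fin n × ℕ

record Subsquare {n : ℕ} (L : Matrix n n) : Set where
  field
    k     : ℕ
    rows  : Fin k → Fin n
    cols  : Fin k → Fin n
    rows-inj : Injective _≡_ _≡_ rows
    cols-inj : Injective _≡_ _≡_ cols
    latin : IsLatin k (λ a b → L (rows a) (cols b))

_∈S_ : ∀ {n} {L : Matrix n n} → Entry n → Subsquare L → Set
_∈S_ {L = L} (r , c , s) S =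
    (∃ λ a → Subsquare.rows S a ≡ r)
  × (∃ λ b → Subsquare.cols S b ≡ c)
  × L r c ≡ s

_∈M_ : ∀ {n} → Entry n → Matrix n n → Set
(r , c , s) ∈M L = L r c ≡ s

-- Row r₁ of a subsquare S containing π must carry every symbol of any other row of S,
-- and outside the alien cell L agrees with a Latin square, so every symbol other than
-- k₁ occurs at most once in each row and column of L.
-- If r₂ were a row of S, the symbol k₂ at (r₂, c₁) would force c₂ into S, then k₃ at
-- (r₂, c₂) would force c₃ into S, and finally k₄ at (r₂, c₃) would have to occur in
-- row r₁ of L, where the displaced native k₄ occurs nowhere. This excludes the three
-- entries in row r₂. If c₂ were a column of S, the symbol k₂ at (r₁, c₂) would have to
-- occur in column c₁ of S, which only happens at (r₂, c₁).
module Submission where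

open import Defs
open import Data.Nat using (ℕ)
open import Data.Fin using (Fin; _≟_)
open import Data.Product using (∃; _×_; _,_; proj₁; proj₂)
open import Data.Sum using (_⊎_; inj₁; inj₂)
open import Data.List using (_∷_; [])
open import Data.List.Membership.Propositional using (_∈_)
open import Data.List.Relation.Unary.Any using (here; there)
open import Data.Empty using (⊥-elim)
open import Relation.Nullary using (¬_; yes; no)
open import Relation.Binary.PropositionalEquality
  using (_≡_; _≢_; refl; sym; trans; cong; subst; module ≡-Reasoning)

module _ {n : ℕ} {M : Matrix n n} where

  latin-row-injective : IsLatin n M → ∀ r {x y} → M r x ≡ M r y → x ≡ y
  latin-row-injective (_ , _ , entry , row-unique , _) r {x} eq
    with entry r x
  ... | s , Mrx≡s with row-unique r s
  ...   | _ , _ , unique = trans (unique x Mrx≡s) (sym (unique _ (trans (sym eq) Mrx≡s)))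

  latin-col-injective : IsLatin n M → ∀ c {x y} → M x c ≡ M y c → x ≡ y
  latin-col-injective (_ , _ , entry , _ , col-unique) c {x} eq
    with entry x c
  ... | s , Mxc≡s with col-unique c s
  ...   | _ , _ , unique = trans (unique x Mxc≡s) (sym (unique _ (trans (sym eq) Mxc≡s)))

  latin-row-covers : IsLatin n M → ∀ r c r' → ∃ λ c' → M r' c' ≡ M r c
  latin-row-covers (_ , _ , entry , row-unique , _) r c r'
    with entry r c
  ... | s , Mrc≡s with row-unique r' s
  ...   | c' , Mr'c'≡s , _ = c' , trans Mr'c'≡s (sym Mrc≡s)

  latin-col-covers : IsLatin n M → ∀ r c c' → ∃ λ r' → M r' c' ≡ M r c
  latin-col-covers (_ , _ , entry , _ , col-unique) r c c'
    with entry r c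
  ... | s , Mrc≡s with col-unique c' s
  ...   | r' , Mr'c'≡s , _ = r' , trans Mr'c'≡s (sym Mrc≡s)

module _ {n : ℕ} {L : Matrix n n} where

  open Subsquare

  HasRow : Subsquare L → Fin n → Set
  HasRow S r = ∃ λ a → rows S a ≡ r

  HasCol : Subsquare L → Fin n → Set
  HasCol S c = ∃ λ b → cols S b ≡ c

  subsquare-row-covers : (S : Subsquare L) → ∀ {r r' c} →
    HasRow S r → HasRow S r' → HasCol S c → ∃ λ c' → HasCol S c' × L r' c' ≡ L r c
  subsquare-row-covers S (a , refl) (a' , refl) (b , refl)
    with latin-row-covers (latin S) a b a'
  ... | b' , eq = cols S b' , (b' , refl) , eq

  subsquare-col-covers : (S : Subsquare L) → ∀ {c c' r} →
    HasCol S c → HasCol S c' → HasRow S r → ∃ λ r' → HasRow S r' × L r' c' ≡ L r c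
  subsquare-col-covers S (b , refl) (b' , refl) (a , refl)
    with latin-col-covers (latin S) a b b'
  ... | a' , eq = rows S a' , (a' , refl) , eq

module _ {n : ℕ} {L L' : Matrix n n} {i j : Fin n} {σ : ℕ}
         (latin : IsLatin n L') (near : NearCopyOf L L' i j σ) where

  open ≡-Reasoning

  private
    σ≢native : σ ≢ L' i j
    σ≢native = proj₁ near

    Lij≡σ : L i j ≡ σ
    Lij≡σ = proj₁ (proj₂ near)

  nearCopy-agrees : ∀ r c → L r c ≢ σ → L r c ≡ L' r c
  nearCopy-agrees r c Lrc≢σ with r ≟ i | c ≟ j
  ... | yes refl | yes refl = ⊥-elim (Lrc≢σ Lij≡σ)
  ... | no r≢i   | _        = proj₂ (proj₂ near) r c (inj₁ r≢i)
  ... | _        | no c≢j   = proj₂ (proj₂ near) r c (inj₂ c≢j)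

  nearCopy-row-injective : ∀ r {x y} → L r x ≡ L r y → L r y ≢ σ → x ≡ y
  nearCopy-row-injective r {x} {y} eq Lry≢σ = latin-row-injective latin r (begin
    L' r x ≡⟨ sym (nearCopy-agrees r x (λ Lrx≡σ → Lry≢σ (trans (sym eq) Lrx≡σ))) ⟩
    L r x  ≡⟨ eq ⟩
    L r y  ≡⟨ nearCopy-agrees r y Lry≢σ ⟩
    L' r y ∎)

  nearCopy-col-injective : ∀ c {x y} → L x c ≡ L y c → L y c ≢ σ → x ≡ y
  nearCopy-col-injective c {x} {y} eq Lyc≢σ = latin-col-injective latin c (begin
    L' x c ≡⟨ sym (nearCopy-agrees x c (λ Lxc≡σ → Lyc≢σ (trans (sym eq) Lxc≡σ))) ⟩
    L x c  ≡⟨ eq ⟩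
    L y c  ≡⟨ nearCopy-agrees y c Lyc≢σ ⟩
    L' y c ∎)

  nearCopy-native-absent : ∀ c → L i c ≢ L' i j
  nearCopy-native-absent c Lic≡native = σ≢native (begin
    σ      ≡⟨ sym Lij≡σ ⟩
    L i j  ≡⟨ cong (L i) (sym c≡j) ⟩
    L i c  ≡⟨ Lic≡native ⟩
    L' i j ∎)
    where
    c≡j : c ≡ j
    c≡j = latin-row-injective latin i (begin
      L' i c ≡⟨ sym (nearCopy-agrees i c (λ Lic≡σ → σ≢native (trans (sym Lic≡σ) Lic≡native))) ⟩
      L i c  ≡⟨ Lic≡native ⟩
      L' i j ∎)

  nearCopy-subsquare-col-closed : (S : Subsquare L) → ∀ {r r' c c'} →
    HasRow S r → HasRow S r' → HasCol S c → L r c ≡ L r' c' → L r' c' ≢ σ → HasCol S c'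
  nearCopy-subsquare-col-closed S r∈S r'∈S c∈S eq ≢σ
    with subsquare-row-covers S r∈S r'∈S c∈S
  ... | c'' , c''∈S , eq' = subst (HasCol S) (nearCopy-row-injective _ (trans eq' eq) ≢σ) c''∈S

  nearCopy-subsquare-row-closed : (S : Subsquare L) → ∀ {c c' r r'} →
    HasCol S c → HasCol S c' → HasRow S r → L r c ≡ L r' c' → L r' c' ≢ σ → HasRow S r'
  nearCopy-subsquare-row-closed S c∈S c'∈S r∈S eq ≢σ
    with subsquare-col-covers S c∈S c'∈S r∈S
  ... | r'' , r''∈S , eq' = subst (HasRow S) (nearCopy-col-injective _ (trans eq' eq) ≢σ) r''∈S

lemma3p6 : (n : ℕ) (L L' : Matrix n n) → IsLatin n L' →
    (r₁ r₂ c₁ c₂ c₃ : Fin n) (k₁ k₂ k₃ k₄ : ℕ) →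
    NearCopyOf L L' r₁ c₁ k₁ → L' r₁ c₁ ≡ k₄ →
    k₁ ≢ k₂ → k₁ ≢ k₃ → k₁ ≢ k₄ → k₂ ≢ k₃ → k₂ ≢ k₄ → k₃ ≢ k₄ →
    (∀ e → e ∈ ((r₁ , c₁ , k₁) ∷ (r₂ , c₁ , k₂) ∷ (r₁ , c₂ , k₂)
               ∷ (r₂ , c₂ , k₃) ∷ (r₁ , c₃ , k₃) ∷ (r₂ , c₃ , k₄) ∷ [])
         → e ∈M L) →
    (S : Subsquare L) → (r₁ , c₁ , k₁) ∈S S →
    ∀ e → e ∈ ((r₁ , c₁ , k₁) ∷ (r₂ , c₁ , k₂) ∷ (r₁ , c₂ , k₂)
               ∷ (r₂ , c₂ , k₃) ∷ (r₁ , c₃ , k₃) ∷ (r₂ , c₃ , k₄) ∷ [])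
    → e ∈S S → e ≡ (r₁ , c₁ , k₁) ⊎ e ≡ (r₁ , c₃ , k₃)
lemma3p6 n L L' latin r₁ r₂ c₁ c₂ c₃ k₁ k₂ k₃ k₄ near native k₁≢k₂ k₁≢k₃ _ _ _ _ D S (r₁∈S , c₁∈S , _) = classify
  where
  e₂ : L r₂ c₁ ≡ k₂
  e₂ = D _ (there (here refl))
  e₃ : L r₁ c₂ ≡ k₂
  e₃ = D _ (there (there (here refl)))
  e₄ : L r₂ c₂ ≡ k₃
  e₄ = D _ (there (there (there (here refl))))
  e₅ : L r₁ c₃ ≡ k₃
  e₅ = D _ (there (there (there (there (here refl)))))
  e₆ : L r₂ c₃ ≡ k₄
  e₆ = D _ (there (there (there (there (there (here refl))))))

  not-alien : ∀ {r c k} → L r c ≡ k → k₁ ≢ k → L r c ≢ k₁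
  not-alien Lrc≡k k₁≢k Lrc≡k₁ = k₁≢k (trans (sym Lrc≡k₁) Lrc≡k)

  r₂∉S : ¬ HasRow S r₂
  r₂∉S r₂∈S =
    let c , _ , Lr₁c≡Lr₂c₃ = subsquare-row-covers S r₂∈S r₁∈S c₃∈S
    in  nearCopy-native-absent latin near c (trans Lr₁c≡Lr₂c₃ (trans e₆ (sym native)))
    where
    c₂∈S : HasCol S c₂
    c₂∈S = nearCopy-subsquare-col-closed latin near S r₂∈S r₁∈S c₁∈S
             (trans e₂ (sym e₃)) (not-alien e₃ k₁≢k₂)
    c₃∈S : HasCol S c₃
    c₃∈S = nearCopy-subsquare-col-closed latin near S r₂∈S r₁∈S c₂∈S
             (trans e₄ (sym e₅)) (not-alien e₅ k₁≢k₃)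

  c₂∉S : ¬ HasCol S c₂
  c₂∉S c₂∈S = r₂∉S (nearCopy-subsquare-row-closed latin near S c₂∈S c₁∈S r₁∈S
                      (trans e₃ (sym e₂)) (not-alien e₂ k₁≢k₂))

  classify : ∀ e → e ∈ ((r₁ , c₁ , k₁) ∷ (r₂ , c₁ , k₂) ∷ (r₁ , c₂ , k₂)
                        ∷ (r₂ , c₂ , k₃) ∷ (r₁ , c₃ , k₃) ∷ (r₂ , c₃ , k₄) ∷ [])
    → e ∈S S → e ≡ (r₁ , c₁ , k₁) ⊎ e ≡ (r₁ , c₃ , k₃)
  classify _ (here refl) _ = inj₁ refl
  classify _ (there (here refl)) (r₂∈S , _) = ⊥-elim (r₂∉S r₂∈S)
  classify _ (there (there (here refl))) (_ , c₂∈S , _) = ⊥-elim (c₂∉S c₂∈S)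
  classify _ (there (there (there (here refl)))) (r₂∈S , _) = ⊥-elim (r₂∉S r₂∈S)
  classify _ (there (there (there (there (here refl))))) _ = inj₂ refl
  classify _ (there (there (there (there (there (here refl)))))) (r₂∈S , _) = ⊥-elim (r₂∉S r₂∈S)
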